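{- Let $P_k(m) = 2(m-1)^{k+1} + (k+1)(m-1)^{k} - 2(k+1)m^{k} + (k-1)$. Then: (1) for every even $k \geq 4$: $P_k(k-1) < 0$; $P_k(2(k-1)) < 0$ for $k \in \{4,6\}$; and $P_k(2(k-1)) > 0$ for every even $k \geq 8$; (2) for every odd $k \geq 5$: $P_k(k-2) < 0$; (3) for every odd $k \geq 3$: $P_k(k+1) < 0$; $P_k((k+1)(k-2)) < 0$ for $k = 3$; and $P_k((k+1)(k-2)) > 0$ for every odd $k \geq 5$. In particular, $P_k$ does not vanish at any of these points, and for odd $k\ge 3$ neither does $Q_k(m) = P_k(m)/m$.
   Context: $P_k(m)$ equals $2(k+1)\left(S_{\mathbb{R}}(m-1,k) - m^k\right)$ with $S_{\mathbb{R}}(m-1,k) = \frac{(m-1)^{k+1}-1}{k+1} + \frac{1+(m-1)^k}{2}$, the Euler–MacLaurin approximation (integral plus boundary terms only) of $\sum_{i=1}^{m-1} i^k$. -}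

module Defs where

open import Data.Nat as ℕ using (ℕ; suc; NonZero)
open import Data.Integer using (ℤ; +_; _+_; _-_; _*_; _^_)
open import Data.Rational.Unnormalised using (ℚᵘ; _/_)

P : ℕ → ℕ → ℤ
P k m = + 2 * ((+ m - + 1) ^ suc k) + (+ suc k) * ((+ m - + 1) ^ k)
        - + 2 * (+ suc k) * ((+ m) ^ k) + (+ k - + 1)

Q : ℕ → (m : ℕ) → .{{NonZero m}} → ℚᵘ
Q k m = P k m / m

{-# OPTIONS --safe #-}
-- With a = m − 1 and k ≥ 1, P_k(a + 1) = P⁺ − P⁻ where P⁺ = a^k (2a + k + 1) + (k − 1) and
-- P⁻ = 2(k + 1)(a + 1)^k, so the sign of P is decided by comparing (1 + 1/a)^k with
-- (2a + k + 1)/(2(k + 1)). Bernoulli's inequality (1 + 1/a)^k ≥ 1 + k/a gives P < 0 whenever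
-- 2 ≤ m ≤ k + 1, which covers every negative case except P_4(6) and P_6(10). For the positive
-- cases the reverse bound (1 + 1/s)^h ≤ s/(s − h) reduces P > 0 to a polynomial inequality in k.
-- The small cases P_4(6), P_6(10) and P_8(14) are evaluated.
module Submission where

open import Defs
open import Data.Nat as ℕ using (ℕ; zero; suc; pred; _+_; _*_; _^_; _∸_; _≤_; _≥_; z≤n; s≤s; NonZero)
open import Data.Nat.Properties as ℕ using (module ≤-Reasoning)
open import Data.Nat.Divisibility using (_∣_; divides)
open import Data.Nat.Tactic.RingSolver using (solve-∀; solve)
open import Data.Integer as ℤ using (+_; _<_; _>_)
import Data.Integer.Properties as ℤ
import Data.Integer.Tactic.RingSolver as ℤ-Ring
open import Data.Rational.Unnormalised using (_≃_; 0ℚᵘ)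
import Data.Rational.Unnormalised.Properties as ℚᵘ
open import Data.List using ([]; _∷_)
open import Data.Product using (_×_; _,_)
open import Data.Sum using (_⊎_; inj₁; inj₂)
open import Relation.Nullary using (¬_; contradiction)
open import Relation.Nullary.Decidable using (from-yes)
open import Relation.Binary.PropositionalEquality
  using (_≡_; _≢_; ≢-sym; refl; sym; trans; cong; cong₂; subst; subst₂; module ≡-Reasoning)

P⁺ : ℕ → ℕ → ℕ
P⁺ k a = a ^ k * (2 * a + suc k) + pred k

P⁻ : ℕ → ℕ → ℕ
P⁻ k a = 2 * suc k * suc a ^ k

pos-^ : ∀ m n → + (m ^ n) ≡ (+ m) ℤ.^ n
pos-^ m zero    = refl
pos-^ m (suc n) = trans (ℤ.pos-* m (m ^ n)) (cong (+ m ℤ.*_) (pos-^ m n))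

P≡P⁺⊖P⁻ : ∀ k .{{_ : NonZero k}} a → P k (suc a) ≡ P⁺ k a ℤ.⊖ P⁻ k a
P≡P⁺⊖P⁻ k@(suc j) a = begin
  P k (suc a)
    ≡⟨ regroup (+ a) ((+ a) ℤ.^ k) ((+ suc a) ℤ.^ k) (+ suc k) (+ j) ⟩
  ((+ a) ℤ.^ k ℤ.* (+ 2 ℤ.* + a ℤ.+ + suc k) ℤ.+ + j) ℤ.- + 2 ℤ.* + suc k ℤ.* (+ suc a) ℤ.^ k
    ≡⟨ cong₂ ℤ._-_ cast⁺ cast⁻ ⟨
  + P⁺ k a ℤ.- + P⁻ k a
    ≡⟨ ℤ.[+m]-[+n]≡m⊖n (P⁺ k a) (P⁻ k a) ⟩
  P⁺ k a ℤ.⊖ P⁻ k a ∎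
  where
  open ≡-Reasoning
  regroup : ∀ a A C K J →
    + 2 ℤ.* (a ℤ.* A) ℤ.+ K ℤ.* A ℤ.- + 2 ℤ.* K ℤ.* C ℤ.+ J
      ≡ (A ℤ.* (+ 2 ℤ.* a ℤ.+ K) ℤ.+ J) ℤ.- + 2 ℤ.* K ℤ.* C
  regroup = ℤ-Ring.solve-∀
  cast⁺ : + P⁺ k a ≡ (+ a) ℤ.^ k ℤ.* (+ 2 ℤ.* + a ℤ.+ + suc k) ℤ.+ + j
  cast⁺ = begin
    + P⁺ k a
      ≡⟨ ℤ.pos-+ (a ^ k * (2 * a + suc k)) j ⟩
    + (a ^ k * (2 * a + suc k)) ℤ.+ + j
      ≡⟨ cong (ℤ._+ + j) (ℤ.pos-* (a ^ k) (2 * a + suc k)) ⟩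
    + (a ^ k) ℤ.* + (2 * a + suc k) ℤ.+ + j
      ≡⟨ cong₂ (λ x y → x ℤ.* y ℤ.+ + j) (pos-^ a k)
               (trans (ℤ.pos-+ (2 * a) (suc k)) (cong (ℤ._+ + suc k) (ℤ.pos-* 2 a))) ⟩
    (+ a) ℤ.^ k ℤ.* (+ 2 ℤ.* + a ℤ.+ + suc k) ℤ.+ + j ∎
  cast⁻ : + P⁻ k a ≡ + 2 ℤ.* + suc k ℤ.* (+ suc a) ℤ.^ k
  cast⁻ = begin
    + P⁻ k a                                 ≡⟨ ℤ.pos-* (2 * suc k) (suc a ^ k) ⟩
    + (2 * suc k) ℤ.* + (suc a ^ k)          ≡⟨ cong₂ ℤ._*_ (ℤ.pos-* 2 (suc k)) (pos-^ (suc a) k) ⟩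
    + 2 ℤ.* + suc k ℤ.* (+ suc a) ℤ.^ k      ∎

P⁺<P⁻⇒P<0 : ∀ k .{{_ : NonZero k}} a → P⁺ k a ℕ.< P⁻ k a → P k (suc a) < + 0
P⁺<P⁻⇒P<0 k a P⁺<P⁻ = begin-strict
  P k (suc a)              ≡⟨ P≡P⁺⊖P⁻ k a ⟩
  P⁺ k a ℤ.⊖ P⁻ k a        <⟨ ℤ.⊖-monoʳ->-< (P⁺ k a) P⁺<P⁻ ⟩
  P⁺ k a ℤ.⊖ P⁺ k a        ≡⟨ ℤ.n⊖n≡0 (P⁺ k a) ⟩
  + 0                      ∎
  where open ℤ.≤-Reasoning

P⁻<P⁺⇒P>0 : ∀ k .{{_ : NonZero k}} a → P⁻ k a ℕ.< P⁺ k a → P k (suc a) > + 0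
P⁻<P⁺⇒P>0 k a P⁻<P⁺ = begin-strict
  + 0                      ≡⟨ ℤ.n⊖n≡0 (P⁻ k a) ⟨
  P⁻ k a ℤ.⊖ P⁻ k a        <⟨ ℤ.⊖-monoˡ-< (P⁻ k a) P⁻<P⁺ ⟩
  P⁺ k a ℤ.⊖ P⁻ k a        ≡⟨ P≡P⁺⊖P⁻ k a ⟨
  P k (suc a)              ∎
  where open ℤ.≤-Reasoning

bernoulli : ∀ a n → a ^ n * (a + n) ≤ a * suc a ^ n
bernoulli a zero    = ℕ.≤-reflexive (solve (a ∷ []))
bernoulli a (suc n) = step (a ^ n) (suc a ^ n) (bernoulli a n)
  where
  open ≤-Reasoning
  step : ∀ p q → p * (a + n) ≤ a * q → a * p * (a + suc n) ≤ a * (suc a * q)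
  step p q ih = begin
    a * p * (a + suc n)           ≤⟨ ℕ.m≤m+n _ (p * n) ⟩
    a * p * (a + suc n) + p * n   ≡⟨ solve (a ∷ n ∷ p ∷ []) ⟩
    suc a * (p * (a + n))         ≤⟨ ℕ.*-monoʳ-≤ (suc a) ih ⟩
    suc a * (a * q)               ≡⟨ solve (a ∷ q ∷ []) ⟩
    a * (suc a * q)               ∎

bernoulli-reverse : ∀ h d → suc (h + d) ^ h * d ≤ (h + d) ^ h * (h + d)
bernoulli-reverse zero    d = ℕ.≤-refl
bernoulli-reverse (suc h) d = step (suc (h + d)) (suc (suc (h + d)) ^ h) (suc (h + d) ^ h) d≤s ih
  where
  open ≤-Reasoning
  d≤s : d ≤ suc (h + d)
  d≤s = ℕ.m≤n⇒m≤1+n (ℕ.m≤n+m d h)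
  ih : suc (suc (h + d)) ^ h * suc d ≤ suc (h + d) ^ h * suc (h + d)
  ih = subst (λ s → suc s ^ h * suc d ≤ s ^ h * s) (ℕ.+-suc h d) (bernoulli-reverse h (suc d))
  step : ∀ s p r → d ≤ s → p * suc d ≤ r * s → suc s * p * d ≤ s * r * s
  step s p r d≤s ih = begin
    suc s * p * d     ≡⟨ solve (s ∷ p ∷ d ∷ []) ⟩
    p * (d + s * d)   ≤⟨ ℕ.*-monoʳ-≤ p (ℕ.+-mono-≤ d≤s (ℕ.≤-reflexive (ℕ.*-comm s d))) ⟩
    p * (s + d * s)   ≡⟨ ℕ.*-assoc p (suc d) s ⟨
    p * suc d * s     ≤⟨ ℕ.*-monoˡ-≤ s ih ⟩
    r * s * s         ≡⟨ solve (s ∷ r ∷ []) ⟩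
    s * r * s         ∎

P⁺<P⁻ : ∀ {k a} .{{_ : NonZero k}} .{{_ : NonZero a}} → a ≤ k → P⁺ k a ℕ.< P⁻ k a
P⁺<P⁻ {k@(suc j)} {a@(suc b)} a≤k =
  ℕ.*-cancelˡ-< a _ _ (estimate (a ^ k) (suc a ^ k) {{ℕ.m^n≢0 a k}} (bernoulli a k))
  where
  open ≤-Reasoning
  estimate : ∀ p q .{{_ : NonZero p}} → p * (a + k) ≤ a * q →
             a * (p * (2 * a + suc k) + j) ℕ.< a * (2 * suc k * q)
  estimate p q bern = begin-strict
    a * (p * (2 * a + suc k) + j)             ≡⟨ solve (b ∷ j ∷ p ∷ []) ⟩
    p * (a * (2 * a + suc k)) + a * j         ≤⟨ ℕ.+-monoʳ-≤ _ (ℕ.m≤n*m (a * j) p) ⟩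
    p * (a * (2 * a + suc k)) + p * (a * j)   ≡⟨ solve (b ∷ j ∷ p ∷ []) ⟩
    p * (2 * a * (a + k))                     <⟨ ℕ.*-monoʳ-< p (ℕ.*-monoˡ-< (a + k) (ℕ.*-monoʳ-< 2 (s≤s a≤k))) ⟩
    p * (2 * suc k * (a + k))                 ≡⟨ solve (b ∷ j ∷ p ∷ []) ⟩
    2 * suc k * (p * (a + k))                 ≤⟨ ℕ.*-monoʳ-≤ (2 * suc k) bern ⟩
    2 * suc k * (a * q)                       ≡⟨ solve (b ∷ j ∷ q ∷ []) ⟩
    a * (2 * suc k * q)                       ∎

P<0 : ∀ {k m} → 2 ≤ m → m ≤ suc k → P k m < + 0
P<0 {zero}  (s≤s (s≤s _)) (s≤s ())
P<0 {suc j} {suc (suc b)} (s≤s (s≤s _)) (s≤s a≤k) = P⁺<P⁻⇒P<0 (suc j) (suc b) (P⁺<P⁻ a≤k)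

P[k∸n]<0 : ∀ {k} n → 2 + n ≤ k → P k (k ∸ n) < + 0
P[k∸n]<0 {k} n 2+n≤k = P<0 (ℕ.m+n≤o⇒m≤o∸n 2 2+n≤k) (ℕ.≤-trans (ℕ.m∸n≤m k n) (ℕ.n≤1+n k))

P[1+k]<0 : ∀ {k} → k ≥ 1 → P k (suc k) < + 0
P[1+k]<0 k≥1 = P<0 (s≤s k≥1) ℕ.≤-refl

P⁻<P⁺ : ∀ k a .{{_ : NonZero a}} D A → suc a ^ k * D ≤ a ^ k * A →
        2 * suc k * A ℕ.< D * (2 * a + suc k) → P⁻ k a ℕ.< P⁺ k a
P⁻<P⁺ k a D A bound poly =
  ℕ.*-cancelˡ-< D _ _ (estimate (a ^ k) (suc a ^ k) {{ℕ.m^n≢0 a k}} bound)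
  where
  open ≤-Reasoning
  estimate : ∀ p q .{{_ : NonZero p}} → q * D ≤ p * A →
             D * (2 * suc k * q) ℕ.< D * (p * (2 * a + suc k) + pred k)
  estimate p q bound = begin-strict
    D * (2 * suc k * q)                  ≡⟨ solve (k ∷ q ∷ D ∷ []) ⟩
    2 * suc k * (q * D)                  ≤⟨ ℕ.*-monoʳ-≤ (2 * suc k) bound ⟩
    2 * suc k * (p * A)                  ≡⟨ solve (k ∷ p ∷ A ∷ []) ⟩
    p * (2 * suc k * A)                  <⟨ ℕ.*-monoʳ-< p poly ⟩
    p * (D * (2 * a + suc k))            ≡⟨ solve (k ∷ a ∷ p ∷ D ∷ []) ⟩
    D * (p * (2 * a + suc k))            ≤⟨ ℕ.*-monoʳ-≤ D (ℕ.m≤m+n _ (pred k)) ⟩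
    D * (p * (2 * a + suc k) + pred k)   ∎

m+[1+o]≡n⇒m<n : ∀ {m n} o → m + suc o ≡ n → m ℕ.< n
m+[1+o]≡n⇒m<n {m} o refl = ℕ.m<m+n m ℕ.z<s

P>0-at-[1+k][k∸2] : ∀ k → k ≥ 5 → P k (suc k * (k ∸ 2)) > + 0
P>0-at-[1+k][k∸2] k (s≤s (s≤s (s≤s (s≤s (s≤s {n = t} _))))) =
  subst (λ m → P k m > + 0) (1+a≡[1+k][k∸2] t) (P⁻<P⁺⇒P>0 k a (P⁻<P⁺ k a d a bound (poly t)))
  where
  a d : ℕ
  a = 17 + 9 * t + t * t
  d = 12 + 8 * t + t * t
  1+a≡[1+k][k∸2] : ∀ t → 18 + 9 * t + t * t ≡ (6 + t) * (3 + t)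
  1+a≡[1+k][k∸2] = solve-∀
  k+d≡a : ∀ t → 5 + t + (12 + 8 * t + t * t) ≡ 17 + 9 * t + t * t
  k+d≡a = solve-∀
  bound : suc a ^ k * d ≤ a ^ k * a
  bound = subst (λ s → suc s ^ k * d ≤ s ^ k * s) (k+d≡a t) (bernoulli-reverse k d)
  poly : ∀ t → 2 * (6 + t) * (17 + 9 * t + t * t)
               ℕ.< (12 + 8 * t + t * t) * (2 * (17 + 9 * t + t * t) + (6 + t))
  poly t = m+[1+o]≡n⇒m<n (275 + 406 * t + 186 * (t * t) + 33 * (t * t * t) + 2 * (t * t * t * t)) (excess t)
    where
    excess : ∀ t → 2 * (6 + t) * (17 + 9 * t + t * t)
                     + suc (275 + 406 * t + 186 * (t * t) + 33 * (t * t * t) + 2 * (t * t * t * t))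
                   ≡ (12 + 8 * t + t * t) * (2 * (17 + 9 * t + t * t) + (6 + t))
    excess = solve-∀

-- The reverse Bernoulli bound with exponent k is too weak at a = 2k − 3; it is used with
-- exponent k/2 and squared.
P>0-at-2[k∸1] : ∀ h → h ≥ 4 → P (h * 2) (2 * (h * 2 ∸ 1)) > + 0
P>0-at-2[k∸1] _ (s≤s (s≤s (s≤s (s≤s {n = zero} _)))) = from-yes (+ 0 ℤ.<? P 8 14)
P>0-at-2[k∸1] h (s≤s (s≤s (s≤s (s≤s {n = suc t} _)))) =
  subst (λ m → P (h * 2) m > + 0) 1+a≡2[k∸1]
        (P⁻<P⁺⇒P>0 (h * 2) a (P⁻<P⁺ (h * 2) a (d * d) (a * a) bound² (poly t)))
  where
  a d : ℕ
  a = 17 + 4 * t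
  d = 12 + 3 * t
  1+a≡2[k∸1] : suc a ≡ 2 * (h * 2 ∸ 1)
  1+a≡2[k∸1] = identity t
    where
    identity : ∀ t → 18 + 4 * t ≡ 2 * suc ((4 + t) * 2)
    identity = solve-∀
  h+d≡a : ∀ t → 5 + t + (12 + 3 * t) ≡ 17 + 4 * t
  h+d≡a = solve-∀
  bound : suc a ^ h * d ≤ a ^ h * a
  bound = subst (λ s → suc s ^ h * d ≤ s ^ h * s) (h+d≡a t) (bernoulli-reverse h d)
  squared : ∀ {p q u v} → p * u ≤ q * v → (p * p) * (u * u) ≤ (q * q) * (v * v)
  squared {p} {q} {u} {v} pu≤qv = begin
    (p * p) * (u * u)    ≡⟨ solve (p ∷ u ∷ []) ⟩
    (p * u) * (p * u)    ≤⟨ ℕ.*-mono-≤ pu≤qv pu≤qv ⟩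
    (q * v) * (q * v)    ≡⟨ solve (q ∷ v ∷ []) ⟩
    (q * q) * (v * v)    ∎
    where open ≤-Reasoning
  ^h*^h≡^[h*2] : ∀ x → x ^ h * x ^ h ≡ x ^ (h * 2)
  ^h*^h≡^[h*2] x = trans (cong (x ^ h *_) (sym (ℕ.*-identityʳ (x ^ h)))) (ℕ.^-*-assoc x h 2)
  bound² : suc a ^ (h * 2) * (d * d) ≤ a ^ (h * 2) * (a * a)
  bound² = subst₂ (λ x y → x * (d * d) ≤ y * (a * a)) (^h*^h≡^[h*2] (suc a)) (^h*^h≡^[h*2] a)
                  (squared {suc a ^ h} {a ^ h} {d} {a} bound)
  poly : ∀ t → 2 * (11 + t * 2) * ((17 + 4 * t) * (17 + 4 * t))
               ℕ.< ((12 + 3 * t) * (12 + 3 * t)) * (2 * (17 + 4 * t) + (11 + t * 2))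
  poly t = m+[1+o]≡n⇒m<n (121 + 532 * t + 229 * (t * t) + 26 * (t * t * t)) (excess t)
    where
    excess : ∀ t → 2 * (11 + t * 2) * ((17 + 4 * t) * (17 + 4 * t))
                     + suc (121 + 532 * t + 229 * (t * t) + 26 * (t * t * t))
                   ≡ ((12 + 3 * t) * (12 + 3 * t)) * (2 * (17 + 4 * t) + (11 + t * 2))
    excess = solve-∀

P[4,6]<0 : P 4 6 < + 0
P[4,6]<0 = from-yes (P 4 6 ℤ.<? + 0)

P[6,10]<0 : P 6 10 < + 0
P[6,10]<0 = from-yes (P 6 10 ℤ.<? + 0)

P≢0-at-2[k∸1] : ∀ k → 2 ∣ k → k ≥ 4 → P k (2 * (k ∸ 1)) ≢ + 0
P≢0-at-2[k∸1] _ (divides 0 refl) ()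
P≢0-at-2[k∸1] _ (divides 1 refl) (s≤s (s≤s ()))
P≢0-at-2[k∸1] _ (divides 2 refl) _ = ℤ.<⇒≢ P[4,6]<0
P≢0-at-2[k∸1] _ (divides 3 refl) _ = ℤ.<⇒≢ P[6,10]<0
P≢0-at-2[k∸1] _ (divides h@(suc (suc (suc (suc _)))) refl) _ =
  ≢-sym (ℤ.<⇒≢ (P>0-at-2[k∸1] h (s≤s (s≤s (s≤s (s≤s z≤n))))))

P≢0-at-[1+k][k∸2] : ∀ k → ¬ 2 ∣ k → k ≥ 3 → P k (suc k * (k ∸ 2)) ≢ + 0
P≢0-at-[1+k][k∸2] k k-odd k≥3 with ℕ.m≤n⇒m<n∨m≡n k≥3
... | inj₂ refl = ℤ.<⇒≢ (P[1+k]<0 {3} (s≤s z≤n))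
... | inj₁ k≥4 with ℕ.m≤n⇒m<n∨m≡n k≥4
...   | inj₂ refl = contradiction (divides 2 refl) k-odd
...   | inj₁ k≥5 = ≢-sym (ℤ.<⇒≢ (P>0-at-[1+k][k∸2] k k≥5))

Q≃0⇒P≡0 : ∀ k m .{{_ : NonZero m}} → Q k m ≃ 0ℚᵘ → P k m ≡ + 0
Q≃0⇒P≡0 k (suc m) = ℚᵘ.p≃0⇒↥p≡0 (Q k (suc m))

lemma14 :
    -- (1) even k
    ((k : ℕ) → 2 ∣ k → k ≥ 4 → P k (k ∸ 1) < + 0)
    × (P 4 (2 ℕ.* (4 ∸ 1)) < + 0)
    × (P 6 (2 ℕ.* (6 ∸ 1)) < + 0)
    × ((k : ℕ) → 2 ∣ k → k ≥ 8 → P k (2 ℕ.* (k ∸ 1)) > + 0)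
    -- (2) odd k ≥ 5
    × ((k : ℕ) → ¬ (2 ∣ k) → k ≥ 5 → P k (k ∸ 2) < + 0)
    -- (3) odd k ≥ 3
    × ((k : ℕ) → ¬ (2 ∣ k) → k ≥ 3 → P k (suc k) < + 0)
    × (P 3 (suc 3 ℕ.* (3 ∸ 2)) < + 0)
    × ((k : ℕ) → ¬ (2 ∣ k) → k ≥ 5 → P k (suc k ℕ.* (k ∸ 2)) > + 0)
    -- in particular: P_k does not vanish at these points
    × ((k : ℕ) → 2 ∣ k → k ≥ 4 → (m : ℕ)
         → m ≡ k ∸ 1 ⊎ m ≡ 2 ℕ.* (k ∸ 1) → P k m ≢ + 0)
    × ((k : ℕ) → ¬ (2 ∣ k) → (m : ℕ)
         → (k ≥ 5 × m ≡ k ∸ 2) ⊎ (k ≥ 3 × (m ≡ suc k ⊎ m ≡ suc k ℕ.* (k ∸ 2)))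
         → P k m ≢ + 0)
    -- and, for odd k ≥ 3, neither does Q_k(m) = P_k(m)/m
    × ((k : ℕ) → ¬ (2 ∣ k) → (m : ℕ) → .{{_ : NonZero m}}
         → (k ≥ 5 × m ≡ k ∸ 2) ⊎ (k ≥ 3 × (m ≡ suc k ⊎ m ≡ suc k ℕ.* (k ∸ 2)))
         → ¬ (Q k m ≃ 0ℚᵘ))
lemma14 =
    (λ k _ k≥4 → P[k∸n]<0 1 (ℕ.<⇒≤ k≥4))
  , P[4,6]<0
  , P[6,10]<0
  , (λ { _ (divides h refl) k≥8 → P>0-at-2[k∸1] h (ℕ.*-cancelʳ-≤ 4 h 2 k≥8) })
  , (λ k _ k≥5 → P[k∸n]<0 2 (ℕ.<⇒≤ k≥5))
  , (λ k _ k≥3 → P[1+k]<0 (ℕ.m+n≤o⇒n≤o 2 k≥3))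
  , P[1+k]<0 {3} (s≤s z≤n)
  , (λ k _ → P>0-at-[1+k][k∸2] k)
  , P≢0-even
  , P≢0-odd
  , (λ k k-odd m cases Q≃0 → P≢0-odd k k-odd m cases (Q≃0⇒P≡0 k m Q≃0))
  where
  P≢0-even : ∀ k → 2 ∣ k → k ≥ 4 → ∀ m → m ≡ k ∸ 1 ⊎ m ≡ 2 * (k ∸ 1) → P k m ≢ + 0
  P≢0-even k _      k≥4 _ (inj₁ refl) = ℤ.<⇒≢ (P[k∸n]<0 1 (ℕ.<⇒≤ k≥4))
  P≢0-even k k-even k≥4 _ (inj₂ refl) = P≢0-at-2[k∸1] k k-even k≥4
  P≢0-odd : ∀ k → ¬ 2 ∣ k → ∀ m → (k ≥ 5 × m ≡ k ∸ 2) ⊎ (k ≥ 3 × (m ≡ suc k ⊎ m ≡ suc k * (k ∸ 2)))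
            → P k m ≢ + 0
  P≢0-odd k _     _ (inj₁ (k≥5 , refl))        = ℤ.<⇒≢ (P[k∸n]<0 2 (ℕ.<⇒≤ k≥5))
  P≢0-odd k _     _ (inj₂ (k≥3 , inj₁ refl))   = ℤ.<⇒≢ (P[1+k]<0 (ℕ.m+n≤o⇒n≤o 2 k≥3))
  P≢0-odd k k-odd _ (inj₂ (k≥3 , inj₂ refl))   = P≢0-at-[1+k][k∸2] k k-odd k≥3
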